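{- If $m$ and $n$ are non-negative integers, then \[ \sum_{k = 1}^n k^m u_k = -\delta_{m,0}u_0 - n^m \frac{u_{n + 2}}q + \frac1{q^{m + 1}} \sum_{j = 0}^m A(m,j)u_{j + m + 1} - \sum_{s = 1}^m \frac1{q^{s + 1}} \binom ms n^{m - s} \sum_{j = 1}^s A(s,j)u_{j + n + s + 1}, \] \[ \sum_{k = 1}^n k^m v_k = -\delta_{m,0}v_0 - n^m \frac{v_{n + 2}}q + \frac1{q^{m + 1}} \sum_{j = 0}^m A(m,j)v_{j + m + 1} - \sum_{s = 1}^m \frac1{q^{s + 1}} \binom ms n^{m - s} \sum_{j = 1}^s A(s,j)v_{j + n + s + 1}. \]
   Context: Let $q$ be a nonzero complex number. The sequences $(u_j)$ and $(v_j)$ are defined by $u_0=0$, $u_1=1$, $v_0=2$, $v_1=1$ and $x_j=x_{j-1}-qx_{j-2}$ ($j\ge2$) for both. $\delta_{m,0}$ is the Kronecker delta. The Eulerian numbers are $A(i,j)=\sum_{t=0}^j(-1)^t\binom{i+1}{t}(j-t)^i$ for non-negative integers $i,j$, with $0^0=1$. Empty sums are $0$. -}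

module Defs where

open import Level using (Level)
open import Data.Nat using (ℕ; zero; suc; _∸_) renaming (_+_ to _+ℕ_; _*_ to _*ℕ_; _^_ to _^ℕ_)
open import Data.Nat.Combinatorics using (_C_)
open import Algebra.Bundles using (CommutativeRing)

module _ {c ℓ : Level} (R : CommutativeRing c ℓ) where
  open CommutativeRing R

  natR : ℕ → Carrier
  natR zero = 0#
  natR (suc n) = 1# + natR n

  pow : Carrier → ℕ → Carrier
  pow x zero = 1#
  pow x (suc n) = x * pow x n

  sumFrom : ℕ → ℕ → (ℕ → Carrier) → Carrier
  sumFrom a zero f = 0#
  sumFrom a (suc l) f = f a + sumFrom (suc a) l f

  -- Σ_{k=a}^{b} f k  (empty, i.e. 0, when b < a)
  sumFT : ℕ → ℕ → (ℕ → Carrier) → Carrier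
  sumFT a b f = sumFrom a (suc b ∸ a) f

  δ0 : ℕ → Carrier
  δ0 zero = 1#
  δ0 (suc _) = 0#

  eulerA : ℕ → ℕ → Carrier
  eulerA i j = sumFT 0 j (λ t → pow (- 1#) t * natR (((suc i) C t) *ℕ ((j ∸ t) ^ℕ i)))

  lucasU : Carrier → ℕ → Carrier
  lucasU q zero = 0#
  lucasU q (suc zero) = 1#
  lucasU q (suc (suc j)) = lucasU q (suc j) - q * lucasU q j

  lucasV : Carrier → ℕ → Carrier
  lucasV q zero = 1# + 1#
  lucasV q (suc zero) = 1#
  lucasV q (suc (suc j)) = lucasV q (suc j) - q * lucasV q j

  -- right-hand side of Theorem 5 for a sequence x, with qinv = 1/q
  theorem5RHS : Carrier → (ℕ → Carrier) → ℕ → ℕ → Carrier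
  theorem5RHS qinv x m n =
    ((- (δ0 m * x 0) - (pow (natR n) m * (x (n +ℕ 2) * qinv)))
     + pow qinv (suc m) * sumFT 0 m (λ j → eulerA m j * x (j +ℕ m +ℕ 1)))
    - sumFT 1 m (λ s → pow qinv (suc s) * (natR (m C s) * (pow (natR n) (m ∸ s)
        * sumFT 1 s (λ j → eulerA s j * x (j +ℕ n +ℕ s +ℕ 1)))))

  theorem5LHS : (ℕ → Carrier) → ℕ → ℕ → Carrier
  theorem5LHS x m n = sumFT 1 n (λ k → pow (natR k) m * x k)

{-# OPTIONS --safe #-}
-- Let c(n) be the coefficient sequence of (1 - z)^(m+1) Σ_i (i+n)^m z^i, which vanishes beyond
-- degree m, and G(n) = q^-(m+1) Σ_{j ≤ m} c(n)_j x_{n+m+1+j}. The recurrence in the form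
-- x_{k+1} - x_{k+2} = q x_k gives Σ_j ((1 - z) f)_j x_{k+1+j} = q Σ_j f_j x_{k+j} for every
-- finitely supported f. Since Σ_i (i+n)^m z^i = n^m + z Σ_i (i+n+1)^m z^i, this yields
-- G(n) = n^m x_n + G(n+1), and the sum telescopes to G(1) - G(n+1). Expanding (i+n)^m
-- binomially and using that (1 - z)^(s+1) Σ_i i^s z^i has the Eulerian numbers A(s,j) as
-- coefficients turns G(0) and G(n+1) into the Eulerian sums of the right-hand side.
module Submission where

open import Defs
open import Level using (Level)
open import Function.Base using (_∘_)
open import Data.Nat.Base using (ℕ; zero; suc; _∸_; _<_; _≤_; z≤n; s≤s)
  renaming (_+_ to _+ℕ_; _*_ to _*ℕ_; _^_ to _^ℕ_)
import Data.Nat.Properties as ℕₚ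
open import Data.Nat.Combinatorics using (_C_; nCn≡1; nCk+nC[k+1]≡[n+1]C[k+1])
open import Data.Product.Base using (_×_; _,_)
open import Data.Maybe.Base using (nothing)
open import Algebra.Bundles using (CommutativeRing)
open import Relation.Binary.PropositionalEquality as ≡ using (_≡_)

module FiniteSums {c ℓ : Level} (R : CommutativeRing c ℓ) where
  open CommutativeRing R
  open import Algebra.Properties.Ring ring using (-‿+-comm; -0#≈0#)
  open import Algebra.Properties.CommutativeSemigroup +-commutativeSemigroup using (interchange)
  open import Relation.Binary.Reasoning.Setoid setoid

  sumFrom-cong : ∀ a l {f g : ℕ → Carrier} → (∀ i → a ≤ i → i < a +ℕ l → f i ≈ g i) →
                 sumFrom R a l f ≈ sumFrom R a l g
  sumFrom-cong a zero    f≈g = refl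
  sumFrom-cong a (suc l) f≈g = +-cong (f≈g a ℕₚ.≤-refl (ℕₚ.m<m+n a (s≤s z≤n)))
    (sumFrom-cong (suc a) l λ i a<i i<a+1+l →
      f≈g i (ℕₚ.<⇒≤ a<i) (≡.subst (i <_) (≡.sym (ℕₚ.+-suc a l)) i<a+1+l))

  sumFrom-zero : ∀ a l {f : ℕ → Carrier} → (∀ i → a ≤ i → i < a +ℕ l → f i ≈ 0#) →
                 sumFrom R a l f ≈ 0#
  sumFrom-zero a zero    f≈0 = refl
  sumFrom-zero a (suc l) f≈0 = trans (sumFrom-cong a (suc l) f≈0) (zeros a l)
    where
    zeros : ∀ a l → sumFrom R a (suc l) (λ _ → 0#) ≈ 0#
    zeros a zero    = +-identityʳ 0#
    zeros a (suc l) = trans (+-identityˡ _) (zeros (suc a) l)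

  sumFrom-suc : ∀ a l (f : ℕ → Carrier) → sumFrom R (suc a) l f ≡ sumFrom R a l (f ∘ suc)
  sumFrom-suc a zero    f = ≡.refl
  sumFrom-suc a (suc l) f = ≡.cong (f (suc a) +_) (sumFrom-suc (suc a) l f)

  sumFrom-snoc : ∀ a l (f : ℕ → Carrier) → sumFrom R a (suc l) f ≈ sumFrom R a l f + f (a +ℕ l)
  sumFrom-snoc a zero    f = trans (+-comm _ _) (+-congˡ (reflexive (≡.cong f (≡.sym (ℕₚ.+-identityʳ a)))))
  sumFrom-snoc a (suc l) f = begin
    f a + sumFrom R (suc a) (suc l) f            ≈⟨ +-congˡ (sumFrom-snoc (suc a) l f) ⟩
    f a + (sumFrom R (suc a) l f + f (suc a +ℕ l)) ≈⟨ +-assoc _ _ _ ⟨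
    sumFrom R a (suc l) f + f (suc a +ℕ l)        ≡⟨ ≡.cong (λ i → sumFrom R a (suc l) f + f i) (ℕₚ.+-suc a l) ⟨
    sumFrom R a (suc l) f + f (a +ℕ suc l)        ∎

  sumFrom-+ : ∀ a l (f g : ℕ → Carrier) →
              sumFrom R a l (λ i → f i + g i) ≈ sumFrom R a l f + sumFrom R a l g
  sumFrom-+ a zero    f g = sym (+-identityʳ 0#)
  sumFrom-+ a (suc l) f g = trans (+-congˡ (sumFrom-+ (suc a) l f g)) (interchange _ _ _ _)

  sumFrom-neg : ∀ a l (f : ℕ → Carrier) → sumFrom R a l (λ i → - f i) ≈ - sumFrom R a l f
  sumFrom-neg a zero    f = sym -0#≈0#
  sumFrom-neg a (suc l) f = trans (+-congˡ (sumFrom-neg (suc a) l f)) (-‿+-comm _ _)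

  sumFrom-- : ∀ a l (f g : ℕ → Carrier) →
              sumFrom R a l (λ i → f i - g i) ≈ sumFrom R a l f - sumFrom R a l g
  sumFrom-- a l f g = trans (sumFrom-+ a l f (λ i → - g i)) (+-congˡ (sumFrom-neg a l g))

  *-distribˡ-sumFrom : ∀ a l x (f : ℕ → Carrier) →
                       x * sumFrom R a l f ≈ sumFrom R a l (λ i → x * f i)
  *-distribˡ-sumFrom a zero    x f = zeroʳ x
  *-distribˡ-sumFrom a (suc l) x f = trans (distribˡ x _ _) (+-congˡ (*-distribˡ-sumFrom (suc a) l x f))

  sumFrom-telescope : ∀ a l (g H : ℕ → Carrier) → (∀ i → H i ≈ g i + H (suc i)) →
                      sumFrom R a l g ≈ H a - H (a +ℕ l)
  sumFrom-telescope a zero    g H step = sym (trans (+-congˡ (-‿cong (reflexive (≡.cong H (ℕₚ.+-identityʳ a)))))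
                                                    (-‿inverseʳ (H a)))
  sumFrom-telescope a (suc l) g H step = begin
    g a + sumFrom R (suc a) l g             ≈⟨ +-congˡ (sumFrom-telescope (suc a) l g H step) ⟩
    g a + (H (suc a) - H (suc a +ℕ l))      ≈⟨ +-assoc _ _ _ ⟨
    (g a + H (suc a)) - H (suc a +ℕ l)      ≈⟨ +-cong (step a) (-‿cong (reflexive (≡.cong H (ℕₚ.+-suc a l)))) ⟨
    H a - H (a +ℕ suc l)                    ∎

module Powers {c ℓ : Level} (R : CommutativeRing c ℓ) where
  open CommutativeRing R
  open FiniteSums R
  open import Algebra.Properties.CommutativeSemigroup *-commutativeSemigroup using (interchange)
  open import Relation.Binary.Reasoning.Setoid setoid

  natR-+ : ∀ a b → natR R (a +ℕ b) ≈ natR R a + natR R b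
  natR-+ zero    b = sym (+-identityˡ _)
  natR-+ (suc a) b = trans (+-congˡ (natR-+ a b)) (sym (+-assoc _ _ _))

  natR-* : ∀ a b → natR R (a *ℕ b) ≈ natR R a * natR R b
  natR-* zero    b = sym (zeroˡ _)
  natR-* (suc a) b = begin
    natR R (b +ℕ a *ℕ b)             ≈⟨ trans (natR-+ b (a *ℕ b)) (+-congˡ (natR-* a b)) ⟩
    natR R b + natR R a * natR R b   ≈⟨ +-congʳ (*-identityˡ _) ⟨
    1# * natR R b + natR R a * natR R b ≈⟨ distribʳ _ _ _ ⟨
    (1# + natR R a) * natR R b       ∎

  pow-cong : ∀ n {x y} → x ≈ y → pow R x n ≈ pow R y n
  pow-cong zero    x≈y = refl
  pow-cong (suc n) x≈y = *-cong x≈y (pow-cong n x≈y)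

  pow-+ : ∀ x a b → pow R x (a +ℕ b) ≈ pow R x a * pow R x b
  pow-+ x zero    b = sym (*-identityˡ _)
  pow-+ x (suc a) b = trans (*-congˡ (pow-+ x a b)) (sym (*-assoc _ _ _))

  pow-* : ∀ x y n → pow R (x * y) n ≈ pow R x n * pow R y n
  pow-* x y zero    = sym (*-identityˡ 1#)
  pow-* x y (suc n) = trans (*-congˡ (pow-* x y n)) (interchange _ _ _ _)

  pow-1# : ∀ n → pow R 1# n ≈ 1#
  pow-1# zero    = refl
  pow-1# (suc n) = trans (*-identityˡ _) (pow-1# n)

  pow-0# : ∀ n → pow R 0# n ≈ δ0 R n
  pow-0# zero    = refl
  pow-0# (suc n) = zeroˡ _

  natR-^ : ∀ a b → natR R (a ^ℕ b) ≈ pow R (natR R a) b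
  natR-^ a zero    = +-identityʳ 1#
  natR-^ a (suc b) = trans (natR-* a (a ^ℕ b)) (*-congˡ (natR-^ a b))

  binomial : ∀ m x y →
             pow R (x + y) m ≈ sumFrom R 0 (suc m) (λ s → natR R (m C s) * (pow R x s * pow R y (m ∸ s)))
  binomial m x y = begin
    pow R (x + y) m                ≈⟨ pow≈^ m ⟩
    (x + y) ^ m                    ≈⟨ theorem m x y ⟩
    sum {suc m} (λ s → term (toℕ s)) ≈⟨ sum≈sumFrom (suc m) term ⟩
    sumFrom R 0 (suc m) term       ≈⟨ sumFrom-cong 0 (suc m) (λ s _ _ →
                                        trans (×≈natR* (m C s) _) (*-congˡ (sym (*-cong (pow≈^ s) (pow≈^ (m ∸ s)))))) ⟩
    sumFrom R 0 (suc m) (λ s → natR R (m C s) * (pow R x s * pow R y (m ∸ s))) ∎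
    where
    open import Algebra.Properties.CommutativeSemiring.Binomial commutativeSemiring using (theorem)
    open import Algebra.Properties.Semiring.Exp semiring using (_^_)
    open import Algebra.Properties.Semiring.Mult semiring using () renaming (_×_ to _·_)
    open import Algebra.Properties.Semiring.Sum semiring using (sum)
    open import Data.Fin.Base using (toℕ)

    term : ℕ → Carrier
    term s = (m C s) · ((x ^ s) * (y ^ (m ∸ s)))

    sum≈sumFrom : ∀ l (f : ℕ → Carrier) → sum {l} (λ i → f (toℕ i)) ≈ sumFrom R 0 l f
    sum≈sumFrom zero    f = refl
    sum≈sumFrom (suc l) f = +-congˡ (trans (sum≈sumFrom l (f ∘ suc)) (reflexive (≡.sym (sumFrom-suc 0 l f))))

    pow≈^ : ∀ {z} n → pow R z n ≈ z ^ n
    pow≈^ zero    = refl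
    pow≈^ (suc n) = *-congˡ (pow≈^ n)

    ×≈natR* : ∀ n z → n · z ≈ natR R n * z
    ×≈natR* zero    z = sym (zeroˡ z)
    ×≈natR* (suc n) z = trans (+-cong (sym (*-identityˡ z)) (×≈natR* n z)) (sym (distribʳ _ _ _))

module BackwardDifferences {c ℓ : Level} (R : CommutativeRing c ℓ) where
  open CommutativeRing R
  open FiniteSums R
  open Powers R
  open import Algebra.Properties.Ring ring using (-0#≈0#; -‿+-comm; -1*x≈-x; x[y-z]≈xy-xz; //-rightDividesʳ)
  open import Algebra.Properties.CommutativeSemigroup +-commutativeSemigroup using (interchange)
  open import Relation.Binary.Reasoning.Setoid setoid

  infix 4 _≋_
  _≋_ : (ℕ → Carrier) → (ℕ → Carrier) → Set ℓ
  f ≋ g = ∀ j → f j ≈ g j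

  -- On coefficient sequences of power series, delay is multiplication by z and ∇ by 1 - z.
  delay : (ℕ → Carrier) → ℕ → Carrier
  delay f zero    = 0#
  delay f (suc j) = f j

  ∇ : (ℕ → Carrier) → ℕ → Carrier
  ∇ f j = f j - delay f j

  ∇^ : ℕ → (ℕ → Carrier) → ℕ → Carrier
  ∇^ zero    f = f
  ∇^ (suc k) f = ∇ (∇^ k f)

  Supported : ℕ → (ℕ → Carrier) → Set ℓ
  Supported d f = ∀ j → d < j → f j ≈ 0#

  power : ℕ → ℕ → Carrier
  power s i = pow R (natR R i) s

  delay-cong : ∀ {f g} → f ≋ g → delay f ≋ delay g
  delay-cong f≋g zero    = refl
  delay-cong f≋g (suc j) = f≋g j

  ∇-cong : ∀ {f g} → f ≋ g → ∇ f ≋ ∇ g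
  ∇-cong f≋g j = +-cong (f≋g j) (-‿cong (delay-cong f≋g j))

  ∇^-cong : ∀ k {f g} → f ≋ g → ∇^ k f ≋ ∇^ k g
  ∇^-cong zero    f≋g = f≋g
  ∇^-cong (suc k) f≋g = ∇-cong (∇^-cong k f≋g)

  ∇^-∇^ : ∀ a b f → ∇^ a (∇^ b f) ≡ ∇^ (a +ℕ b) f
  ∇^-∇^ zero    b f = ≡.refl
  ∇^-∇^ (suc a) b f = ≡.cong ∇ (∇^-∇^ a b f)

  ∇^-suc : ∀ k f → ∇^ (suc k) f ≡ ∇^ k (∇ f)
  ∇^-suc k f = ≡.trans (≡.cong (λ i → ∇^ i f) (ℕₚ.+-comm 1 k)) (≡.sym (∇^-∇^ k 1 f))

  ∇-+ : ∀ f g → ∇ (λ i → f i + g i) ≋ λ j → ∇ f j + ∇ g j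
  ∇-+ f g zero    = trans (+-congˡ (trans (-‿cong (sym (+-identityʳ 0#))) (sym (-‿+-comm 0# 0#)))) (interchange _ _ _ _)
  ∇-+ f g (suc j) = trans (+-congˡ (sym (-‿+-comm _ _))) (interchange _ _ _ _)

  ∇-*ˡ : ∀ x f → ∇ (λ i → x * f i) ≋ λ j → x * ∇ f j
  ∇-*ˡ x f zero    = trans (+-congˡ (-‿cong (sym (zeroʳ x)))) (sym (x[y-z]≈xy-xz x _ _))
  ∇-*ˡ x f (suc j) = sym (x[y-z]≈xy-xz x _ _)

  ∇-0 : ∇ (λ _ → 0#) ≋ λ _ → 0#
  ∇-0 zero    = -‿inverseʳ 0#
  ∇-0 (suc j) = -‿inverseʳ 0#

  ∇-delay : ∀ f → ∇ (delay f) ≋ delay (∇ f)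
  ∇-delay f zero    = -‿inverseʳ 0#
  ∇-delay f (suc j) = refl

  ∇^-+ : ∀ k f g → ∇^ k (λ i → f i + g i) ≋ λ j → ∇^ k f j + ∇^ k g j
  ∇^-+ zero    f g j = refl
  ∇^-+ (suc k) f g j = trans (∇-cong (∇^-+ k f g) j) (∇-+ (∇^ k f) (∇^ k g) j)

  ∇^-*ˡ : ∀ k x f → ∇^ k (λ i → x * f i) ≋ λ j → x * ∇^ k f j
  ∇^-*ˡ zero    x f j = refl
  ∇^-*ˡ (suc k) x f j = trans (∇-cong (∇^-*ˡ k x f) j) (∇-*ˡ x (∇^ k f) j)

  ∇^-0 : ∀ k → ∇^ k (λ _ → 0#) ≋ λ _ → 0#
  ∇^-0 zero    j = refl
  ∇^-0 (suc k) j = trans (∇-cong (∇^-0 k) j) (∇-0 j)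

  ∇^-delay : ∀ k f → ∇^ k (delay f) ≋ delay (∇^ k f)
  ∇^-delay zero    f j = refl
  ∇^-delay (suc k) f j = trans (∇-cong (∇^-delay k f) j) (∇-delay (∇^ k f) j)

  ∇^-sumFrom : ∀ k a l (x : ℕ → Carrier) (g : ℕ → ℕ → Carrier) →
               ∇^ k (λ i → sumFrom R a l (λ t → x t * g t i)) ≋ λ j → sumFrom R a l (λ t → x t * ∇^ k (g t) j)
  ∇^-sumFrom k a zero    x g j = ∇^-0 k j
  ∇^-sumFrom k a (suc l) x g j =
    trans (∇^-+ k _ _ j) (+-cong (∇^-*ˡ k (x a) (g a) j) (∇^-sumFrom k (suc a) l x g j))

  Supported-∇ : ∀ {d f} → Supported d f → Supported (suc d) (∇ f)
  Supported-∇ f≈0 (suc j) (s≤s d<j) =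
    trans (+-cong (f≈0 (suc j) (ℕₚ.m<n⇒m<1+n d<j)) (-‿cong (f≈0 j d<j))) (-‿inverseʳ 0#)

  Supported-∇^ : ∀ k {d f} → Supported d f → Supported (k +ℕ d) (∇^ k f)
  Supported-∇^ zero    f≈0 = f≈0
  Supported-∇^ (suc k) f≈0 = Supported-∇ (Supported-∇^ k f≈0)

  private
    alternating : ℕ → (ℕ → Carrier) → ℕ → ℕ → Carrier
    alternating k f j t = pow R (- 1#) t * (natR R (k C t) * f (j ∸ t))

  alternating-pascal : ∀ k f j t →
                       alternating k f (suc j) (suc t) - alternating k f j t ≈ alternating (suc k) f (suc j) (suc t)
  alternating-pascal k f j t = begin
    σ * (natR R (k C suc t) * F) - pow R (- 1#) t * (natR R (k C t) * F)
      ≈⟨ +-congˡ (trans (*-assoc _ _ _) (-1*x≈-x _)) ⟨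
    σ * (natR R (k C suc t) * F) + σ * (natR R (k C t) * F)
      ≈⟨ trans (+-comm _ _) (sym (distribˡ σ _ _)) ⟩
    σ * (natR R (k C t) * F + natR R (k C suc t) * F)
      ≈⟨ *-congˡ (trans (sym (distribʳ F _ _)) (*-congʳ (sym (natR-+ (k C t) (k C suc t))))) ⟩
    σ * (natR R (k C t +ℕ k C suc t) * F)
      ≡⟨ ≡.cong (λ n → σ * (natR R n * F)) (nCk+nC[k+1]≡[n+1]C[k+1] k t) ⟩
    σ * (natR R (suc k C suc t) * F) ∎
    where
    σ = pow R (- 1#) (suc t)
    F = f (j ∸ t)

  ∇^-explicit : ∀ k f j → ∇^ k f j ≈ sumFrom R 0 (suc j) (λ t → pow R (- 1#) t * (natR R (k C t) * f (j ∸ t)))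
  ∇^-explicit zero    f j = sym (begin
    alternating 0 f j 0 + sumFrom R 1 j (alternating 0 f j)
      ≈⟨ +-congˡ (sumFrom-zero 1 j (λ { (suc t) _ _ → trans (*-congˡ (zeroˡ _)) (zeroʳ _) })) ⟩
    alternating 0 f j 0 + 0#
      ≈⟨ +-identityʳ _ ⟩
    1# * ((1# + 0#) * f j)
      ≈⟨ trans (*-identityˡ _) (trans (*-congʳ (+-identityʳ 1#)) (*-identityˡ _)) ⟩
    f j ∎)
  ∇^-explicit (suc k) f zero    = trans (+-congˡ -0#≈0#) (trans (+-identityʳ _) (∇^-explicit k f 0))
  ∇^-explicit (suc k) f (suc j) = begin
    ∇^ k f (suc j) - ∇^ k f j
      ≈⟨ +-cong (∇^-explicit k f (suc j)) (-‿cong (∇^-explicit k f j)) ⟩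
    (A 0 + sumFrom R 1 (suc j) A) - sumFrom R 0 (suc j) B
      ≈⟨ +-assoc _ _ _ ⟩
    A 0 + (sumFrom R 1 (suc j) A - sumFrom R 0 (suc j) B)
      ≡⟨ ≡.cong (λ s → A 0 + (s - sumFrom R 0 (suc j) B)) (sumFrom-suc 0 (suc j) A) ⟩
    A 0 + (sumFrom R 0 (suc j) (A ∘ suc) - sumFrom R 0 (suc j) B)
      ≈⟨ +-congˡ (sumFrom-- 0 (suc j) _ _) ⟨
    A 0 + sumFrom R 0 (suc j) (λ t → A (suc t) - B t)
      ≈⟨ +-congˡ (sumFrom-cong 0 (suc j) (λ t _ _ → alternating-pascal k f j t)) ⟩
    C 0 + sumFrom R 0 (suc j) (C ∘ suc)
      ≡⟨ ≡.cong (C 0 +_) (sumFrom-suc 0 (suc j) C) ⟨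
    sumFrom R 0 (suc (suc j)) C ∎
    where
    A = alternating k f (suc j)
    B = alternating k f j
    C = alternating (suc k) f (suc j)

  ∇-power-zero : ∇ (power 0) ≋ δ0 R
  ∇-power-zero zero    = trans (+-congˡ -0#≈0#) (+-identityʳ 1#)
  ∇-power-zero (suc j) = -‿inverseʳ 1#

  power-suc : ∀ s j → power (suc s) j ≈ sumFrom R 0 (suc (suc s)) (λ t → natR R (suc s C t) * delay (power t) j)
  power-suc s zero    = trans (zeroˡ _) (sym (sumFrom-zero 0 (suc (suc s)) (λ t _ _ → zeroʳ _)))
  power-suc s (suc i) = begin
    pow R (1# + natR R i) (suc s)      ≈⟨ pow-cong (suc s) (+-comm _ _) ⟩
    pow R (natR R i + 1#) (suc s)      ≈⟨ binomial (suc s) (natR R i) 1# ⟩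
    sumFrom R 0 (suc (suc s)) (λ t → natR R (suc s C t) * (power t i * pow R 1# (suc s ∸ t)))
      ≈⟨ sumFrom-cong 0 (suc (suc s)) (λ t _ _ → *-congˡ (trans (*-congˡ (pow-1# (suc s ∸ t))) (*-identityʳ _))) ⟩
    sumFrom R 0 (suc (suc s)) (λ t → natR R (suc s C t) * power t i) ∎

  ∇-power-suc : ∀ s → ∇ (power (suc s)) ≋ λ j → sumFrom R 0 (suc s) (λ t → natR R (suc s C t) * delay (power t) j)
  ∇-power-suc s j = begin
    power (suc s) j - d                            ≈⟨ +-congʳ (trans (power-suc s j) (sumFrom-snoc 0 (suc s) _)) ⟩
    (lower + natR R (suc s C suc s) * d) - d       ≡⟨ ≡.cong (λ n → (lower + natR R n * d) - d) (nCn≡1 (suc s)) ⟩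
    (lower + (1# + 0#) * d) - d                    ≈⟨ +-congʳ (+-congˡ (trans (*-congʳ (+-identityʳ 1#)) (*-identityˡ d))) ⟩
    (lower + d) - d                                ≈⟨ //-rightDividesʳ d lower ⟩
    lower                                          ∎
    where
    d = delay (power (suc s)) j
    lower = sumFrom R 0 (suc s) (λ t → natR R (suc s C t) * delay (power t) j)

  ∇^-power-vanishes : ∀ {k s j} → s < k → k ≤ j → ∇^ k (power s) j ≈ 0#
  ∇^-power-vanishes {suc k} {zero} {j} _ k<j = begin
    ∇^ (suc k) (power 0) j ≡⟨ ≡.cong (λ g → g j) (∇^-suc k (power 0)) ⟩
    ∇^ k (∇ (power 0)) j   ≈⟨ ∇^-cong k ∇-power-zero j ⟩
    ∇^ k (δ0 R) j          ≈⟨ Supported-∇^ k (λ { (suc _) _ → refl }) j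
                                (≡.subst (_< j) (≡.sym (ℕₚ.+-identityʳ k)) k<j) ⟩
    0#                     ∎
  ∇^-power-vanishes {suc k} {suc s} {suc j} (s≤s s<k) (s≤s k≤j) = begin
    ∇^ (suc k) (power (suc s)) (suc j)  ≡⟨ ≡.cong (λ g → g (suc j)) (∇^-suc k (power (suc s))) ⟩
    ∇^ k (∇ (power (suc s))) (suc j)    ≈⟨ ∇^-cong k (∇-power-suc s) (suc j) ⟩
    ∇^ k (λ i → sumFrom R 0 (suc s) (λ t → natR R (suc s C t) * delay (power t) i)) (suc j)
      ≈⟨ ∇^-sumFrom k 0 (suc s) _ _ (suc j) ⟩
    sumFrom R 0 (suc s) (λ t → natR R (suc s C t) * ∇^ k (delay (power t)) (suc j))
      ≈⟨ sumFrom-zero 0 (suc s) (λ t _ t<1+s → trans (*-congˡ (trans (∇^-delay k (power t) (suc j))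
           (∇^-power-vanishes (ℕₚ.<-≤-trans t<1+s s<k) k≤j))) (zeroʳ _)) ⟩
    0#                                  ∎

  Supported-∇^power : ∀ s → Supported s (∇^ (suc s) (power s))
  Supported-∇^power s j s<j = ∇^-power-vanishes ℕₚ.≤-refl s<j

  eulerA≈∇^power : ∀ s j → eulerA R s j ≈ ∇^ (suc s) (power s) j
  eulerA≈∇^power s j = sym (trans (∇^-explicit (suc s) (power s) j) (sumFrom-cong 0 (suc j) λ t _ _ →
    *-congˡ (sym (trans (natR-* (suc s C t) ((j ∸ t) ^ℕ s)) (*-congˡ (natR-^ (j ∸ t) s))))))

  eulerA-suc-zero : ∀ s → eulerA R (suc s) 0 ≈ 0#
  eulerA-suc-zero s = trans (+-identityʳ _) (trans (*-identityˡ _) (trans (natR-* (suc (suc s) C 0) 0) (zeroʳ _)))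

module LinearRecurrence {c ℓ : Level} (R : CommutativeRing c ℓ) where
  open CommutativeRing R
  open FiniteSums R
  open Powers R
  open BackwardDifferences R

  module Pairing (q : Carrier) (x : ℕ → Carrier) (x-rec : ∀ j → x (suc (suc j)) ≈ x (suc j) - q * x j) where
    open import Algebra.Properties.Ring ring using (x[y-z]≈xy-xz; [y-z]x≈yx-zx; ⁻¹-anti-homo‿-; //-rightDividesˡ)
    open import Algebra.Properties.CommutativeSemigroup *-commutativeSemigroup using (x∙yz≈y∙xz)
    open import Relation.Binary.Reasoning.Setoid setoid

    pairing : ℕ → (ℕ → Carrier) → ℕ → Carrier
    pairing d f k = sumFrom R 0 (suc d) (λ j → f j * x (k +ℕ j))

    pairing-cong : ∀ d {f g} k → f ≋ g → pairing d f k ≈ pairing d g k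
    pairing-cong d k f≋g = sumFrom-cong 0 (suc d) (λ j _ _ → *-congʳ (f≋g j))

    pairing-+ : ∀ d f g k → pairing d (λ i → f i + g i) k ≈ pairing d f k + pairing d g k
    pairing-+ d f g k = trans (sumFrom-cong 0 (suc d) (λ j _ _ → distribʳ _ _ _)) (sumFrom-+ 0 (suc d) _ _)

    pairing-- : ∀ d f g k → pairing d (λ i → f i - g i) k ≈ pairing d f k - pairing d g k
    pairing-- d f g k = trans (sumFrom-cong 0 (suc d) (λ j _ _ → [y-z]x≈yx-zx _ _ _)) (sumFrom-- 0 (suc d) _ _)

    pairing-*ˡ : ∀ d y f k → pairing d (λ i → y * f i) k ≈ y * pairing d f k
    pairing-*ˡ d y f k = trans (sumFrom-cong 0 (suc d) (λ j _ _ → *-assoc _ _ _)) (sym (*-distribˡ-sumFrom 0 (suc d) y _))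

    pairing-sumFrom : ∀ d a l (y : ℕ → Carrier) (g : ℕ → ℕ → Carrier) k →
                      pairing d (λ i → sumFrom R a l (λ t → y t * g t i)) k ≈ sumFrom R a l (λ t → y t * pairing d (g t) k)
    pairing-sumFrom d a zero    y g k = sumFrom-zero 0 (suc d) (λ j _ _ → zeroˡ _)
    pairing-sumFrom d a (suc l) y g k =
      trans (pairing-+ d _ _ k) (+-cong (pairing-*ˡ d (y a) (g a) k) (pairing-sumFrom d (suc a) l y g k))

    pairing-≡ : ∀ {d d′ k k′} f → d ≡ d′ → k ≡ k′ → pairing d f k ≈ pairing d′ f k′
    pairing-≡ f ≡.refl ≡.refl = refl

    pairing-δ0 : ∀ k → pairing 0 (δ0 R) k ≈ x k
    pairing-δ0 k = trans (+-identityʳ _) (trans (*-identityˡ _) (reflexive (≡.cong x (ℕₚ.+-identityʳ k))))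

    pairing-extend : ∀ d f k → Supported d f → pairing (suc d) f k ≈ pairing d f k
    pairing-extend d f k f≈0 = trans (sumFrom-snoc 0 (suc d) _)
      (trans (+-congˡ (trans (*-congʳ (f≈0 (suc d) ℕₚ.≤-refl)) (zeroˡ _))) (+-identityʳ _))

    pairing-delay : ∀ d f k → pairing (suc d) (delay f) k ≈ pairing d f (suc k)
    pairing-delay d f k = begin
      0# * x (k +ℕ 0) + sumFrom R 1 (suc d) (λ j → delay f j * x (k +ℕ j))
        ≈⟨ trans (+-congʳ (zeroˡ _)) (+-identityˡ _) ⟩
      sumFrom R 1 (suc d) (λ j → delay f j * x (k +ℕ j))
        ≡⟨ sumFrom-suc 0 (suc d) _ ⟩
      sumFrom R 0 (suc d) (λ j → f j * x (k +ℕ suc j))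
        ≈⟨ sumFrom-cong 0 (suc d) (λ j _ _ → *-congˡ (reflexive (≡.cong x (ℕₚ.+-suc k j)))) ⟩
      pairing d f (suc k) ∎

    x-step : ∀ j → x (suc j) - x (suc (suc j)) ≈ q * x j
    x-step j = begin
      x (suc j) - x (suc (suc j))         ≈⟨ +-congˡ (-‿cong (x-rec j)) ⟩
      x (suc j) - (x (suc j) - q * x j)   ≈⟨ +-congˡ (⁻¹-anti-homo‿- _ _) ⟩
      x (suc j) + (q * x j - x (suc j))   ≈⟨ +-comm _ _ ⟩
      (q * x j - x (suc j)) + x (suc j)   ≈⟨ //-rightDividesˡ _ _ ⟩
      q * x j                             ∎

    pairing-∇ : ∀ d f k → Supported d f → q * pairing d f k ≈ pairing (suc d) (∇ f) (suc k)
    pairing-∇ d f k f≈0 = sym (begin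
      pairing (suc d) (∇ f) (suc k)
        ≈⟨ pairing-- (suc d) f (delay f) (suc k) ⟩
      pairing (suc d) f (suc k) - pairing (suc d) (delay f) (suc k)
        ≈⟨ +-cong (pairing-extend d f (suc k) f≈0) (-‿cong (pairing-delay d f (suc k))) ⟩
      pairing d f (suc k) - pairing d f (suc (suc k))
        ≈⟨ sumFrom-- 0 (suc d) _ _ ⟨
      sumFrom R 0 (suc d) (λ j → f j * x (suc (k +ℕ j)) - f j * x (suc (suc (k +ℕ j))))
        ≈⟨ sumFrom-cong 0 (suc d) (λ j _ _ → trans (sym (x[y-z]≈xy-xz _ _ _))
             (trans (*-congˡ (x-step (k +ℕ j))) (x∙yz≈y∙xz _ _ _))) ⟩
      sumFrom R 0 (suc d) (λ j → q * (f j * x (k +ℕ j)))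
        ≈⟨ *-distribˡ-sumFrom 0 (suc d) q _ ⟨
      q * pairing d f k ∎)

    pairing-∇^ : ∀ r d f k → Supported d f → pow R q r * pairing d f k ≈ pairing (r +ℕ d) (∇^ r f) (r +ℕ k)
    pairing-∇^ zero    d f k f≈0 = *-identityˡ _
    pairing-∇^ (suc r) d f k f≈0 = trans (*-assoc _ _ _) (trans (*-congˡ (pairing-∇^ r d f k f≈0))
      (pairing-∇ (r +ℕ d) (∇^ r f) (r +ℕ k) (Supported-∇^ r f≈0)))

    pairing-eulerA : ∀ s k → pairing s (∇^ (suc s) (power s)) k ≈ sumFrom R 0 (suc s) (λ j → eulerA R s j * x (k +ℕ j))
    pairing-eulerA s k = sumFrom-cong 0 (suc s) (λ j _ _ → *-congʳ (sym (eulerA≈∇^power s j)))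

    pairing-eulerA-suc : ∀ s k → pairing (suc s) (∇^ (suc (suc s)) (power (suc s))) k
                                   ≈ sumFrom R 1 (suc s) (λ j → eulerA R (suc s) j * x (k +ℕ j))
    pairing-eulerA-suc s k = begin
      pairing (suc s) (∇^ (suc (suc s)) (power (suc s))) k
        ≈⟨ pairing-eulerA (suc s) k ⟩
      eulerA R (suc s) 0 * x (k +ℕ 0) + sumFrom R 1 (suc s) (λ j → eulerA R (suc s) j * x (k +ℕ j))
        ≈⟨ +-congʳ (trans (*-congʳ (eulerA-suc-zero s)) (zeroˡ _)) ⟩
      0# + sumFrom R 1 (suc s) (λ j → eulerA R (suc s) j * x (k +ℕ j))
        ≈⟨ +-identityˡ _ ⟩
      sumFrom R 1 (suc s) (λ j → eulerA R (suc s) j * x (k +ℕ j)) ∎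

  module Telescoping (q qinv : Carrier) (q*qinv≈1 : q * qinv ≈ 1#)
                     (x : ℕ → Carrier) (x-rec : ∀ j → x (suc (suc j)) ≈ x (suc j) - q * x j) where
    open Pairing q x x-rec
    open import Algebra.Properties.Ring ring using (x[y-z]≈xy-xz; [y-z]x≈yx-zx; //-rightDividesʳ; -‿+-comm; xyx⁻¹≈y)
    open import Algebra.Properties.CommutativeSemigroup *-commutativeSemigroup using (x∙yz≈y∙xz)
    open import Algebra.Properties.CommutativeSemigroup +-commutativeSemigroup using ()
      renaming (x∙yz≈y∙xz to x+yz≈y+xz; xy∙z≈xz∙y to xy+z≈xz+y)
    open import Algebra.Solver.Ring.NaturalCoefficients commutativeSemiring (λ _ _ → nothing)
    open import Data.Nat.Tactic.RingSolver using (solve-∀)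
    open import Relation.Binary.Reasoning.Setoid setoid

    qinv^r*q^r≈1 : ∀ r → pow R qinv r * pow R q r ≈ 1#
    qinv^r*q^r≈1 r = trans (sym (pow-* qinv q r)) (trans (pow-cong r (trans (*-comm qinv q) q*qinv≈1)) (pow-1# r))

    shifted : ℕ → ℕ → ℕ → Carrier
    shifted m n i = pow R (natR R i + natR R n) m

    -- The formal tail Σ_{k ≥ n} k^m x_k, as remainder-step shows.
    remainder : ℕ → ℕ → Carrier
    remainder m n = pow R qinv (suc m) * pairing m (∇^ (suc m) (shifted m n)) (suc (m +ℕ n))

    shifted-split : ∀ m n → shifted m n ≋ λ i → pow R (natR R n) m * δ0 R i + delay (shifted m (suc n)) i
    shifted-split m n zero    = trans (pow-cong m (+-identityˡ _)) (sym (trans (+-identityʳ _) (*-identityʳ _)))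
    shifted-split m n (suc i) = trans (pow-cong m (trans (+-assoc _ _ _) (x+yz≈y+xz _ _ _)))
                                      (sym (trans (+-congʳ (zeroʳ _)) (+-identityˡ _)))

    ∇^-shifted : ∀ k m n → ∇^ k (shifted m n) ≋
                 λ j → sumFrom R 0 (suc m) (λ s → natR R (m C s) * pow R (natR R n) (m ∸ s) * ∇^ k (power s) j)
    ∇^-shifted k m n j = trans (∇^-cong k expand j) (∇^-sumFrom k 0 (suc m) _ power j)
      where
      expand : shifted m n ≋ λ i → sumFrom R 0 (suc m) (λ s → natR R (m C s) * pow R (natR R n) (m ∸ s) * power s i)
      expand i = trans (binomial m (natR R i) (natR R n))
        (sumFrom-cong 0 (suc m) (λ s _ _ → trans (*-congˡ (*-comm _ _)) (sym (*-assoc _ _ _))))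

    Supported-∇^shifted : ∀ m n → Supported m (∇^ (suc m) (shifted m n))
    Supported-∇^shifted m n j m<j = trans (∇^-shifted (suc m) m n j)
      (sumFrom-zero 0 (suc m) (λ s _ s<1+m → trans (*-congˡ (∇^-power-vanishes s<1+m m<j)) (zeroʳ _)))

    remainder-step : ∀ m n → remainder m n ≈ pow R (natR R n) m * x n + remainder m (suc n)
    remainder-step m n = begin
      Q * pairing m (∇^ (suc m) (shifted m n)) K
        ≈⟨ *-congˡ (sym (pairing-extend m _ K (Supported-∇^shifted m n))) ⟩
      Q * pairing (suc m) (∇^ (suc m) (shifted m n)) K
        ≈⟨ *-congˡ (pairing-cong (suc m) K split) ⟩
      Q * pairing (suc m) (λ j → N * ∇^ (suc m) (δ0 R) j + delay (∇^ (suc m) (shifted m (suc n))) j) K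
        ≈⟨ *-congˡ (trans (pairing-+ (suc m) _ _ K) (+-cong (pairing-*ˡ (suc m) N _ K) (pairing-delay m _ K))) ⟩
      Q * (N * pairing (suc m) (∇^ (suc m) (δ0 R)) K + pairing m (∇^ (suc m) (shifted m (suc n))) (suc K))
        ≈⟨ *-congˡ (+-cong (*-congˡ unit)
             (pairing-≡ {m} (∇^ (suc m) (shifted m (suc n))) ≡.refl (≡.cong suc (≡.sym (ℕₚ.+-suc m n))))) ⟩
      Q * (N * (pow R q (suc m) * x n) + pairing m (∇^ (suc m) (shifted m (suc n))) (suc (m +ℕ suc n)))
        ≈⟨ distribˡ Q _ _ ⟩
      Q * (N * (pow R q (suc m) * x n)) + remainder m (suc n)
        ≈⟨ +-congʳ (trans (x∙yz≈y∙xz Q N _) (*-congˡ (trans (sym (*-assoc _ _ _))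
             (trans (*-congʳ (qinv^r*q^r≈1 (suc m))) (*-identityˡ (x n)))))) ⟩
      N * x n + remainder m (suc n) ∎
      where
      Q = pow R qinv (suc m)
      N = pow R (natR R n) m
      K = suc (m +ℕ n)
      split : ∇^ (suc m) (shifted m n) ≋ λ j → N * ∇^ (suc m) (δ0 R) j + delay (∇^ (suc m) (shifted m (suc n))) j
      split j = trans (∇^-cong (suc m) (shifted-split m n) j)
        (trans (∇^-+ (suc m) _ _ j) (+-cong (∇^-*ˡ (suc m) N (δ0 R) j) (∇^-delay (suc m) _ j)))
      unit : pairing (suc m) (∇^ (suc m) (δ0 R)) K ≈ pow R q (suc m) * x n
      unit = sym (trans (*-congˡ (sym (pairing-δ0 n)))
        (trans (pairing-∇^ (suc m) 0 (δ0 R) n (λ { (suc _) _ → refl })) (pairing-≡ _ (ℕₚ.+-identityʳ (suc m)) ≡.refl)))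

    remainderTerm : ℕ → ℕ → ℕ → Carrier
    remainderTerm m n s = pow R qinv (suc s)
      * (natR R (m C s) * (pow R (natR R n) (m ∸ s) * pairing s (∇^ (suc s) (power s)) (suc (s +ℕ n))))

    remainder-expand : ∀ m n → remainder m n ≈ sumFrom R 0 (suc m) (remainderTerm m n)
    remainder-expand m n = begin
      Q * pairing m (∇^ (suc m) (shifted m n)) K
        ≈⟨ *-congˡ (pairing-cong m K (∇^-shifted (suc m) m n)) ⟩
      Q * pairing m (λ j → sumFrom R 0 (suc m) (λ s → coeff s * ∇^ (suc m) (power s) j)) K
        ≈⟨ *-congˡ (pairing-sumFrom m 0 (suc m) coeff _ K) ⟩
      Q * sumFrom R 0 (suc m) (λ s → coeff s * pairing m (∇^ (suc m) (power s)) K)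
        ≈⟨ *-distribˡ-sumFrom 0 (suc m) Q _ ⟩
      sumFrom R 0 (suc m) (λ s → Q * (coeff s * pairing m (∇^ (suc m) (power s)) K))
        ≈⟨ sumFrom-cong 0 (suc m) (λ s _ s<1+m → term s (ℕₚ.≤-pred s<1+m)) ⟩
      sumFrom R 0 (suc m) (remainderTerm m n) ∎
      where
      Q = pow R qinv (suc m)
      K = suc (m +ℕ n)
      coeff = λ s → natR R (m C s) * pow R (natR R n) (m ∸ s)
      term : ∀ s → s ≤ m → Q * (coeff s * pairing m (∇^ (suc m) (power s)) K) ≈ remainderTerm m n s
      term s s≤m = begin
        Q * (coeff s * pairing m (∇^ (suc m) (power s)) K)
          ≈⟨ *-cong (reflexive (≡.cong (pow R qinv) (≡.sym r+1+s≡1+m))) (*-congˡ lower) ⟩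
        pow R qinv (r +ℕ suc s) * (coeff s * (pow R q r * P))
          ≈⟨ *-congʳ (trans (pow-+ qinv r (suc s)) (*-comm _ _)) ⟩
        (pow R qinv (suc s) * pow R qinv r) * ((natR R (m C s) * pow R (natR R n) r) * (pow R q r * P))
          ≈⟨ solve 6 (λ a b c n d p → (a :* b) :* ((c :* n) :* (d :* p)) := (a :* (c :* (n :* p))) :* (b :* d))
                     refl _ _ _ _ _ _ ⟩
        (pow R qinv (suc s) * (natR R (m C s) * (pow R (natR R n) r * P))) * (pow R qinv r * pow R q r)
          ≈⟨ trans (*-congˡ (qinv^r*q^r≈1 r)) (*-identityʳ _) ⟩
        pow R qinv (suc s) * (natR R (m C s) * (pow R (natR R n) r * P)) ∎
        where
        r = m ∸ s
        P = pairing s (∇^ (suc s) (power s)) (suc (s +ℕ n))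
        r+s≡m : r +ℕ s ≡ m
        r+s≡m = ℕₚ.m∸n+n≡m s≤m
        r+1+s≡1+m : r +ℕ suc s ≡ suc m
        r+1+s≡1+m = ≡.trans (ℕₚ.+-suc r s) (≡.cong suc r+s≡m)
        lower : pairing m (∇^ (suc m) (power s)) K ≈ pow R q r * P
        lower = sym (begin
          pow R q r * P
            ≈⟨ pairing-∇^ r s _ (suc (s +ℕ n)) (Supported-∇^power s) ⟩
          pairing (r +ℕ s) (∇^ r (∇^ (suc s) (power s))) (r +ℕ suc (s +ℕ n))
            ≡⟨ ≡.cong (λ g → pairing (r +ℕ s) g (r +ℕ suc (s +ℕ n))) (≡.trans (∇^-∇^ r (suc s) (power s))
                 (≡.cong (λ i → ∇^ i (power s)) r+1+s≡1+m)) ⟩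
          pairing (r +ℕ s) (∇^ (suc m) (power s)) (r +ℕ suc (s +ℕ n))
            ≈⟨ pairing-≡ _ r+s≡m (≡.trans (ℕₚ.+-suc r (s +ℕ n))
                 (≡.cong suc (≡.trans (≡.sym (ℕₚ.+-assoc r s n)) (≡.cong (_+ℕ n) r+s≡m)))) ⟩
          pairing m (∇^ (suc m) (power s)) K ∎)

    x-rec-qinv : ∀ n → x (suc (suc n)) * qinv ≈ qinv * x (suc n) - x n
    x-rec-qinv n = begin
      x (suc (suc n)) * qinv              ≈⟨ trans (*-congʳ (x-rec n)) ([y-z]x≈yx-zx _ _ _) ⟩
      x (suc n) * qinv - (q * x n) * qinv ≈⟨ +-cong (*-comm _ _) (-‿cong qxq) ⟩
      qinv * x (suc n) - x n              ∎
      where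
      qxq : (q * x n) * qinv ≈ x n
      qxq = trans (trans (*-assoc _ _ _) (x∙yz≈y∙xz q _ _)) (trans (*-congˡ q*qinv≈1) (*-identityʳ _))

    remainder-zero : ∀ m → remainder m 0 ≈ pow R qinv (suc m) * sumFT R 0 m (λ j → eulerA R m j * x (j +ℕ m +ℕ 1))
    remainder-zero m = *-congˡ (begin
      pairing m (∇^ (suc m) (shifted m 0)) (suc (m +ℕ 0))
        ≈⟨ pairing-cong m _ (∇^-cong (suc m) (λ i → pow-cong m (+-identityʳ _))) ⟩
      pairing m (∇^ (suc m) (power m)) (suc (m +ℕ 0))
        ≈⟨ pairing-eulerA m _ ⟩
      sumFrom R 0 (suc m) (λ j → eulerA R m j * x (suc (m +ℕ 0) +ℕ j))
        ≈⟨ sumFrom-cong 0 (suc m) (λ j _ _ → *-congˡ (reflexive (≡.cong x (index m j)))) ⟩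
      sumFT R 0 m (λ j → eulerA R m j * x (j +ℕ m +ℕ 1)) ∎)
      where
      index : ∀ m j → suc (m +ℕ 0) +ℕ j ≡ j +ℕ m +ℕ 1
      index = solve-∀

    remainder-suc : ∀ m n → pow R (natR R n) m * (x (n +ℕ 2) * qinv)
                      + sumFT R 1 m (λ s → pow R qinv (suc s) * (natR R (m C s) * (pow R (natR R n) (m ∸ s)
                          * sumFT R 1 s (λ j → eulerA R s j * x (j +ℕ n +ℕ s +ℕ 1)))))
                    ≈ remainder m (suc n)
    remainder-suc m n = begin
      N * (x (n +ℕ 2) * qinv) + sumFT R 1 m summand  ≈⟨ +-cong last (sumFrom-cong 1 m (λ { (suc s) _ _ → inner s })) ⟩
      (N * (qinv * x (suc n)) - N * x n) + sumFrom R 1 m T ≈⟨ xy+z≈xz+y _ _ _ ⟩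
      (N * (qinv * x (suc n)) + sumFrom R 1 m T) - N * x n ≈⟨ +-congʳ (+-congʳ head) ⟨
      (T 0 + sumFrom R 1 m T) - N * x n              ≈⟨ +-congʳ (sym (remainder-expand m n)) ⟩
      remainder m n - N * x n                        ≈⟨ +-congʳ (trans (remainder-step m n) (+-comm _ _)) ⟩
      (remainder m (suc n) + N * x n) - N * x n      ≈⟨ //-rightDividesʳ _ _ ⟩
      remainder m (suc n)                            ∎
      where
      N = pow R (natR R n) m
      summand = λ s → pow R qinv (suc s) * (natR R (m C s) * (pow R (natR R n) (m ∸ s)
                   * sumFT R 1 s (λ j → eulerA R s j * x (j +ℕ n +ℕ s +ℕ 1))))
      T = remainderTerm m n

      index : ∀ s n j → suc (s +ℕ n) +ℕ j ≡ j +ℕ n +ℕ s +ℕ 1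
      index = solve-∀

      inner : ∀ s → summand (suc s) ≈ T (suc s)
      inner s = *-congˡ (*-congˡ (*-congˡ (sym (trans (pairing-eulerA-suc s _)
        (sumFrom-cong 1 (suc s) (λ j _ _ → *-congˡ (reflexive (≡.cong x (index (suc s) n j)))))))))

      head : T 0 ≈ N * (qinv * x (suc n))
      head = begin
        (qinv * 1#) * ((1# + 0#) * (N * pairing 0 (∇ (power 0)) (suc n)))
          ≈⟨ *-cong (*-identityʳ qinv) (trans (*-congʳ (+-identityʳ 1#)) (*-identityˡ _)) ⟩
        qinv * (N * pairing 0 (∇ (power 0)) (suc n))
          ≈⟨ x∙yz≈y∙xz _ _ _ ⟩
        N * (qinv * pairing 0 (∇ (power 0)) (suc n))
          ≈⟨ *-congˡ (*-congˡ (trans (pairing-cong 0 (suc n) ∇-power-zero) (pairing-δ0 (suc n)))) ⟩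
        N * (qinv * x (suc n)) ∎

      last : N * (x (n +ℕ 2) * qinv) ≈ N * (qinv * x (suc n)) - N * x n
      last = begin
        N * (x (n +ℕ 2) * qinv)          ≡⟨ ≡.cong (λ i → N * (x i * qinv)) (ℕₚ.+-comm n 2) ⟩
        N * (x (suc (suc n)) * qinv)     ≈⟨ *-congˡ (x-rec-qinv n) ⟩
        N * (qinv * x (suc n) - x n)     ≈⟨ x[y-z]≈xy-xz _ _ _ ⟩
        N * (qinv * x (suc n)) - N * x n ∎

    sum-of-powers-formula : ∀ m n → theorem5LHS R x m n ≈ theorem5RHS R qinv x m n
    sum-of-powers-formula m n = sym (begin
      ((- D - B) + Z) - S                  ≈⟨ solve 4 (λ a b c d → ((a :+ b) :+ c) :+ d := (c :+ a) :+ (b :+ d))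
                                                       refl (- D) (- B) Z (- S) ⟩
      (Z - D) + (- B - S)                  ≈⟨ +-cong (+-congʳ Z≈D+r₁) (-‿+-comm B S) ⟩
      ((D + remainder m 1) - D) - (B + S)  ≈⟨ +-cong (xyx⁻¹≈y D _) (-‿cong (remainder-suc m n)) ⟩
      remainder m 1 - remainder m (suc n)  ≈⟨ sumFrom-telescope 1 n _ (remainder m) (remainder-step m) ⟨
      theorem5LHS R x m n                  ∎)
      where
      D = δ0 R m * x 0
      B = pow R (natR R n) m * (x (n +ℕ 2) * qinv)
      Z = pow R qinv (suc m) * sumFT R 0 m (λ j → eulerA R m j * x (j +ℕ m +ℕ 1))
      S = sumFT R 1 m (λ s → pow R qinv (suc s) * (natR R (m C s) * (pow R (natR R n) (m ∸ s)
            * sumFT R 1 s (λ j → eulerA R s j * x (j +ℕ n +ℕ s +ℕ 1)))))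
      Z≈D+r₁ : Z ≈ D + remainder m 1
      Z≈D+r₁ = trans (sym (remainder-zero m)) (trans (remainder-step m 0) (+-congʳ (*-congʳ (pow-0# m))))

theorem5 : {c ℓ : Level} (R : CommutativeRing c ℓ) →
    let open CommutativeRing R in
    (q qinv : Carrier) → q * qinv ≈ 1# → (m n : ℕ) →
      (theorem5LHS R (lucasU R q) m n ≈ theorem5RHS R qinv (lucasU R q) m n)
      × (theorem5LHS R (lucasV R q) m n ≈ theorem5RHS R qinv (lucasV R q) m n)
theorem5 R q qinv q*qinv≈1 m n =
  LinearRecurrence.Telescoping.sum-of-powers-formula R q qinv q*qinv≈1 (lucasU R q) (λ _ → refl) m n ,
  LinearRecurrence.Telescoping.sum-of-powers-formula R q qinv q*qinv≈1 (lucasV R q) (λ _ → refl) m n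
  where open CommutativeRing R using (refl)
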